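{- For every graph $G$ (with $\bar{\lambda}(G)>0$), $\bar{\lambda}_{\max}(G)/\bar{\lambda}(G)\le 1/2$.
   Context: Graphs are finite and simple. For a graph $G$ of order $n$ and distinct vertices $u,v$, $\lambda_G(u,v)$ is the maximum number of edge-disjoint $u$--$v$ paths, and $\bar{\lambda}(G)=\binom{n}{2}^{ -1}\sum_{\{u,v\}}\lambda_G(u,v)$ over unordered pairs of distinct vertices. An orientation of $G$ is obtained by directing each edge. For a digraph $D$, $\lambda_D(u,v)$ is the maximum number of arc-disjoint directed $u$--$v$ paths and $\bar{\lambda}(D)=\frac{1}{n(n-1)}\sum_{(u,v)}\lambda_D(u,v)$ over ordered pairs of distinct vertices; $\bar{\lambda}_{\max}(G)$ is the maximum of $\bar{\lambda}(D)$ over all orientations $D$ of $G$. -}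

module Defs where

open import Data.Nat using (ℕ; zero; suc; _+_; _*_)
open import Data.Fin using (Fin; zero; suc; _<?_; _≟_)
open import Data.Bool using (Bool; true; false; if_then_else_)
open import Data.List using (List; []; _∷_)
open import Data.List.Relation.Unary.Any using (Any)
open import Data.List.Relation.Unary.Unique.Propositional using (Unique)
open import Data.List.Membership.Propositional using (_∈_)
open import Data.Product using (Σ; ∃; _×_; _,_; proj₁)
open import Data.Sum using (_⊎_)
open import Data.Integer using (+_)
open import Data.Rational using (ℚ; _/_)
open import Relation.Nullary using (¬_; does)
open import Relation.Binary.PropositionalEquality using (_≡_; _≢_)

record Graph (n : ℕ) : Set where
  field
    adj    : Fin n → Fin n → Bool
    sym    : ∀ u v → adj u v ≡ adj v u
    irrefl : ∀ u → adj u u ≡ false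
open Graph public

record Orientation {n : ℕ} (G : Graph n) : Set where
  field
    arc     : Fin n → Fin n → Bool
    arc⊆adj : ∀ u v → arc u v ≡ true → adj G u v ≡ true
    covers  : ∀ u v → adj G u v ≡ true → arc u v ≡ true ⊎ arc v u ≡ true
    antisym : ∀ u v → arc u v ≡ true → arc v u ≡ false
open Orientation public

-- Walks along a (Bool-valued) relation R: for a graph R = adj (undirected
-- since adj is symmetric), for a digraph R = arc (directed walks).
data Walk {n : ℕ} (R : Fin n → Fin n → Bool) : Fin n → Fin n → Set where
  stop : ∀ {u} → Walk R u u
  step : ∀ {u w v} → R u w ≡ true → Walk R w v → Walk R u v

verts : ∀ {n} {R : Fin n → Fin n → Bool} {u v} → Walk R u v → List (Fin n)
verts {u = u} stop = u ∷ []
verts {u = u} (step _ p) = u ∷ verts p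

steps : ∀ {n} {R : Fin n → Fin n → Bool} {u v} → Walk R u v → List (Fin n × Fin n)
steps stop = []
steps (step {u = u} {w = w} _ p) = (u , w) ∷ steps p

Path : ∀ {n} (R : Fin n → Fin n → Bool) → Fin n → Fin n → Set
Path R u v = Σ (Walk R u v) (λ p → Unique (verts p))

SameEdge : ∀ {n} → Fin n × Fin n → Fin n × Fin n → Set
SameEdge (a , b) (c , d) = (a ≡ c × b ≡ d) ⊎ (a ≡ d × b ≡ c)

ShareEdge : ∀ {n} {R : Fin n → Fin n → Bool} {u v u' v'} → Walk R u v → Walk R u' v' → Set
ShareEdge p q = Any (λ e → Any (SameEdge e) (steps q)) (steps p)

ShareArc : ∀ {n} {R : Fin n → Fin n → Bool} {u v u' v'} → Walk R u v → Walk R u' v' → Set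
ShareArc p q = Any (λ e → e ∈ steps q) (steps p)

HasEdgeDisjoint : ∀ {n} → Graph n → Fin n → Fin n → ℕ → Set
HasEdgeDisjoint G u v k =
  Σ (Fin k → Path (adj G) u v) λ P →
    ∀ i j → i ≢ j → ¬ ShareEdge (proj₁ (P i)) (proj₁ (P j))

HasArcDisjoint : ∀ {n} {G : Graph n} → Orientation G → Fin n → Fin n → ℕ → Set
HasArcDisjoint D u v k =
  Σ (Fin k → Path (arc D) u v) λ P →
    ∀ i j → i ≢ j → ¬ ShareArc (proj₁ (P i)) (proj₁ (P j))

IsLambdaG : ∀ {n} → Graph n → Fin n → Fin n → ℕ → Set
IsLambdaG G u v k = HasEdgeDisjoint G u v k × (∀ j → HasEdgeDisjoint G u v j → j Data.Nat.≤ k)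

IsLambdaD : ∀ {n} {G : Graph n} → Orientation G → Fin n → Fin n → ℕ → Set
IsLambdaD D u v k = HasArcDisjoint D u v k × (∀ j → HasArcDisjoint D u v j → j Data.Nat.≤ k)

sumFin : (n : ℕ) → (Fin n → ℕ) → ℕ
sumFin zero f = 0
sumFin (suc n) f = f zero + sumFin n (λ i → f (suc i))

sumUnordered : (n : ℕ) → (Fin n → Fin n → ℕ) → ℕ
sumUnordered n f = sumFin n λ u → sumFin n λ v → if does (u <? v) then f u v else 0

sumOrdered : (n : ℕ) → (Fin n → Fin n → ℕ) → ℕ
sumOrdered n f = sumFin n λ u → sumFin n λ v → if does (u ≟ v) then 0 else f u v

-- averages for graphs of order n = m + 2 (so that the number of pairs is nonzero)
-- λ̄(G) = (n choose 2)⁻¹ Σ_{u<v} λ(u,v) = 2 Σ / (n (n-1))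
avgUnordered : (m : ℕ) → (Fin (suc (suc m)) → Fin (suc (suc m)) → ℕ) → ℚ
avgUnordered m f = (+ (2 * sumUnordered (suc (suc m)) f)) / (suc (suc m) * suc m)

avgOrdered : (m : ℕ) → (Fin (suc (suc m)) → Fin (suc (suc m)) → ℕ) → ℚ
avgOrdered m f = (+ (sumOrdered (suc (suc m)) f)) / (suc (suc m) * suc m)

module Submission where

-- For u ≠ v take λ_D(u,v) arc-disjoint u→v paths and λ_D(v,u) arc-disjoint v→u paths in D.
-- Reversing the second family, both families together form a u–v flow of value
-- λ_D(u,v) + λ_D(v,u) in G. As D orients each edge only one way, an edge carries at most one unit
-- in each direction, and cancelling opposite units leaves a 0/1 flow on an antisymmetric
-- subrelation of the adjacency of G. That flow splits into arc-disjoint u–v walks, which shorten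
-- to edge-disjoint u–v paths of G, so λ_D(u,v) + λ_D(v,u) ≤ λ_G(u,v). Summing over unordered
-- pairs gives Σ_{(u,v)} λ_D(u,v) ≤ Σ_{u<v} λ_G(u,v), that is λ̄(D) ≤ ½ λ̄(G).

open import Defs hiding (sym)

module Sums where

  open import Data.Bool using (Bool; true; false)
  open import Data.Fin using (Fin; zero; suc; _≟_)
  open import Data.Fin.Properties using (suc-injective)
  open import Data.Nat using (ℕ; zero; suc; _+_; _*_; _≤_; _<_; z≤n; s≤s; z<s)
  open import Data.Nat.Properties hiding (_≟_; suc-injective)
  open import Data.Product using (∃; _,_)
  open import Function using (_∘_)
  open import Relation.Nullary using (does; yes; no; contradiction)
  open import Relation.Binary.PropositionalEquality
  open import Algebra.Properties.CommutativeMonoid.Sum +-0-commutativeMonoid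
    using (sum; sum-cong-≗; ∑-distrib-+; ∑-comm)

  𝟙 : Bool → ℕ
  𝟙 true = 1
  𝟙 false = 0

  δ : ∀ {n} → Fin n → Fin n → ℕ
  δ a b = 𝟙 (does (a ≟ b))

  δ-refl : ∀ {n} (a : Fin n) → δ a a ≡ 1
  δ-refl a with a ≟ a
  ... | yes _ = refl
  ... | no a≢a = contradiction refl a≢a

  δ-≢ : ∀ {n} {a b : Fin n} → a ≢ b → δ a b ≡ 0
  δ-≢ {a = a} {b} a≢b with a ≟ b
  ... | yes a≡b = contradiction a≡b a≢b
  ... | no _ = refl

  δ≤1 : ∀ {n} (a b : Fin n) → δ a b ≤ 1
  δ≤1 a b with a ≟ b
  ... | yes _ = s≤s z≤n
  ... | no _ = z≤n

  𝟙-positive : ∀ {b} → 0 < 𝟙 b → b ≡ true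
  𝟙-positive {true} _ = refl

  sumFin≡sum : ∀ n (f : Fin n → ℕ) → sumFin n f ≡ sum f
  sumFin≡sum zero f = refl
  sumFin≡sum (suc n) f = cong (f zero +_) (sumFin≡sum n (f ∘ suc))

  sumFin-cong : ∀ n {f g : Fin n → ℕ} → (∀ i → f i ≡ g i) → sumFin n f ≡ sumFin n g
  sumFin-cong zero f≗g = refl
  sumFin-cong (suc n) f≗g = cong₂ _+_ (f≗g zero) (sumFin-cong n (f≗g ∘ suc))

  sumFin-zero : ∀ n {f : Fin n → ℕ} → (∀ i → f i ≡ 0) → sumFin n f ≡ 0
  sumFin-zero zero f≗0 = refl
  sumFin-zero (suc n) f≗0 = cong₂ _+_ (f≗0 zero) (sumFin-zero n (f≗0 ∘ suc))

  sumFin-const : ∀ n c → sumFin n (λ _ → c) ≡ n * c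
  sumFin-const zero c = refl
  sumFin-const (suc n) c = cong (c +_) (sumFin-const n c)

  sumFin-distrib-+ : ∀ n (f g : Fin n → ℕ) → sumFin n (λ i → f i + g i) ≡ sumFin n f + sumFin n g
  sumFin-distrib-+ n f g = begin
    sumFin n (λ i → f i + g i)  ≡⟨ sumFin≡sum n _ ⟩
    sum (λ i → f i + g i)       ≡⟨ ∑-distrib-+ f g ⟩
    sum f + sum g               ≡⟨ cong₂ _+_ (sumFin≡sum n f) (sumFin≡sum n g) ⟨
    sumFin n f + sumFin n g     ∎
    where open ≡-Reasoning

  sumFin-distribˡ-* : ∀ n c (f : Fin n → ℕ) → sumFin n (λ i → c * f i) ≡ c * sumFin n f
  sumFin-distribˡ-* zero c f = sym (*-zeroʳ c)
  sumFin-distribˡ-* (suc n) c f =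
    trans (cong (c * f zero +_) (sumFin-distribˡ-* n c (f ∘ suc))) (sym (*-distribˡ-+ c _ _))

  sumFin-distribʳ-* : ∀ n c (f : Fin n → ℕ) → sumFin n (λ i → f i * c) ≡ sumFin n f * c
  sumFin-distribʳ-* zero c f = refl
  sumFin-distribʳ-* (suc n) c f =
    trans (cong (f zero * c +_) (sumFin-distribʳ-* n c (f ∘ suc))) (sym (*-distribʳ-+ c (f zero) _))

  sumFin-comm : ∀ m n (f : Fin m → Fin n → ℕ) →
    sumFin m (λ i → sumFin n (f i)) ≡ sumFin n (λ j → sumFin m (λ i → f i j))
  sumFin-comm m n f = begin
    sumFin m (λ i → sumFin n (f i))           ≡⟨ sumFin≡sum m _ ⟩
    sum (λ i → sumFin n (f i))                ≡⟨ sum-cong-≗ (λ i → sumFin≡sum n (f i)) ⟩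
    sum (λ i → sum (f i))                     ≡⟨ ∑-comm f ⟩
    sum (λ j → sum (λ i → f i j))             ≡⟨ sum-cong-≗ (λ j → sumFin≡sum m (λ i → f i j)) ⟨
    sum (λ j → sumFin m (λ i → f i j))        ≡⟨ sumFin≡sum n _ ⟨
    sumFin n (λ j → sumFin m (λ i → f i j))   ∎
    where open ≡-Reasoning

  sumFin-mono-≤ : ∀ n {f g : Fin n → ℕ} → (∀ i → f i ≤ g i) → sumFin n f ≤ sumFin n g
  sumFin-mono-≤ zero f≤g = z≤n
  sumFin-mono-≤ (suc n) f≤g = +-mono-≤ (f≤g zero) (sumFin-mono-≤ n (f≤g ∘ suc))

  sumFin-δ : ∀ {n} (a : Fin n) → sumFin n (δ a) ≡ 1
  sumFin-δ {suc n} zero = cong suc (sumFin-zero n (λ _ → refl))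
  sumFin-δ {suc n} (suc a) = sumFin-δ a

  sumFin-positive : ∀ n (f : Fin n → ℕ) → 0 < sumFin n f → ∃ λ i → 0 < f i
  sumFin-positive (suc n) f pos with f zero in f₀
  ... | suc _ = zero , subst (0 <_) (sym f₀) z<s
  ... | zero with sumFin-positive n (f ∘ suc) pos
  ... | i , fᵢ>0 = suc i , fᵢ>0

  sumFin-≤1 : ∀ n (f : Fin n → ℕ) → (∀ i → f i ≤ 1) →
    (∀ i j → 0 < f i → 0 < f j → i ≡ j) → sumFin n f ≤ 1
  sumFin-≤1 zero f _ _ = z≤n
  sumFin-≤1 (suc n) f f≤1 unique with f zero in f₀
  ... | zero = sumFin-≤1 n (f ∘ suc) (f≤1 ∘ suc)
                 (λ i j fᵢ>0 fⱼ>0 → suc-injective (unique (suc i) (suc j) fᵢ>0 fⱼ>0))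
  ... | suc k = begin
    suc k + sumFin n (f ∘ suc)  ≡⟨ cong (suc k +_) (sumFin-zero n others-vanish) ⟩
    suc k + 0                   ≡⟨ +-identityʳ (suc k) ⟩
    suc k                       ≡⟨ f₀ ⟨
    f zero                      ≤⟨ f≤1 zero ⟩
    1                           ∎
    where
    open ≤-Reasoning
    others-vanish : ∀ i → f (suc i) ≡ 0
    others-vanish i with f (suc i) in fᵢ
    ... | zero = refl
    ... | suc _ with () ← unique zero (suc i) (subst (0 <_) (sym f₀) z<s) (subst (0 <_) (sym fᵢ) z<s)

module Walks where

  open import Data.Bool using (Bool; true; false)
  open import Data.Fin using (Fin; _≟_)
  open import Data.List using (_∷_)
  open import Data.List.Relation.Unary.All using ([])
  open import Data.List.Relation.Unary.All.Properties using (¬Any⇒All¬)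
  open import Data.List.Relation.Unary.AllPairs using ([]; _∷_)
  open import Data.List.Relation.Unary.Any using (Any; here; there)
  open import Data.List.Relation.Unary.Unique.Propositional using (Unique)
  open import Data.List.Relation.Binary.Subset.Propositional using (_⊆_)
  open import Data.List.Membership.Propositional using (_∈_; find; lose)
  open import Data.Empty using (⊥)
  open import Data.Nat using (ℕ)
  open import Data.Product using (Σ; _,_; proj₁)
  open import Data.Sum using (inj₁; inj₂)
  open import Function using (_∘_)
  open import Relation.Nullary using (¬_; yes; no)
  open import Relation.Binary.PropositionalEquality

  BoolRel : ℕ → Set
  BoolRel n = Fin n → Fin n → Bool

  _⊆ʳ_ : ∀ {n} → BoolRel n → BoolRel n → Set
  R ⊆ʳ S = ∀ {a b} → R a b ≡ true → S a b ≡ true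

  module _ {n : ℕ} {R : BoolRel n} where

    mapWalk : ∀ {S} → R ⊆ʳ S → ∀ {u v} → Walk R u v → Walk S u v
    mapWalk R⊆S stop = stop
    mapWalk R⊆S (step r p) = step (R⊆S r) (mapWalk R⊆S p)

    steps-mapWalk : ∀ {S} (R⊆S : R ⊆ʳ S) {u v} (p : Walk R u v) → steps (mapWalk R⊆S p) ≡ steps p
    steps-mapWalk R⊆S stop = refl
    steps-mapWalk R⊆S (step r p) = cong (_ ∷_) (steps-mapWalk R⊆S p)

    ∈steps⇒R : ∀ {u v} (p : Walk R u v) {a b} → (a , b) ∈ steps p → R a b ≡ true
    ∈steps⇒R (step r p) (here refl) = r
    ∈steps⇒R (step r p) (there e∈p) = ∈steps⇒R p e∈p

    ∈steps⇒∈verts : ∀ {u v} (p : Walk R u v) {a b} → (a , b) ∈ steps p → a ∈ verts p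
    ∈steps⇒∈verts (step r p) (here refl) = here refl
    ∈steps⇒∈verts (step r p) (there e∈p) = there (∈steps⇒∈verts p e∈p)

    suffix : ∀ {u v w} (p : Walk R u v) → w ∈ verts p → Walk R w v
    suffix stop (here refl) = stop
    suffix (step r p) (here refl) = step r p
    suffix (step r p) (there w∈p) = suffix p w∈p

    suffix-unique : ∀ {u v w} (p : Walk R u v) (w∈p : w ∈ verts p) →
      Unique (verts p) → Unique (verts (suffix p w∈p))
    suffix-unique stop (here refl) p! = p!
    suffix-unique (step r p) (here refl) p! = p!
    suffix-unique (step r p) (there w∈p) (_ ∷ p!) = suffix-unique p w∈p p!

    suffix-steps : ∀ {u v w} (p : Walk R u v) (w∈p : w ∈ verts p) → steps (suffix p w∈p) ⊆ steps p
    suffix-steps stop (here refl) = λ ()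
    suffix-steps (step r p) (here refl) = λ e∈p → e∈p
    suffix-steps (step r p) (there w∈p) = there ∘ suffix-steps p w∈p

    open import Data.List.Membership.DecPropositional (_≟_ {n}) using (_∈?_)

    walk⇒path : ∀ {u v} (p : Walk R u v) → Σ (Path R u v) λ q → steps (proj₁ q) ⊆ steps p
    walk⇒path stop = (stop , [] ∷ []) , λ ()
    walk⇒path (step {u = u} r p) with walk⇒path p
    ... | (q , q!) , q⊆p with u ∈? verts q
    ... | yes u∈q = (suffix q u∈q , suffix-unique q u∈q q!) , there ∘ q⊆p ∘ suffix-steps q u∈q
    ... | no u∉q = (step r q , ¬Any⇒All¬ (verts q) u∉q ∷ q!) , λ where
      (here refl) → here refl
      (there e∈q) → there (q⊆p e∈q)

    ShareArc-sym : ∀ {u v u' v'} (p : Walk R u v) (q : Walk R u' v') → ShareArc p q → ShareArc q p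
    ShareArc-sym p q shared with find shared
    ... | _ , e∈p , e∈q = lose e∈q e∈p

    arcDisjoint⇒edgeDisjoint : ∀ {S : BoolRel n} → (∀ {x y} → R x y ≡ true → R y x ≡ true → ⊥) →
      ∀ {u v u' v'} (w : Walk R u v) (w' : Walk R u' v') (p : Walk S u v) (p' : Walk S u' v') →
      steps p ⊆ steps w → steps p' ⊆ steps w' → ¬ ShareArc w w' → ¬ ShareEdge p p'
    arcDisjoint⇒edgeDisjoint asym w w' p p' p⊆w p'⊆w' disjoint shared with find shared
    ... | (x , y) , xy∈p , sameEdge with find sameEdge
    ... | _ , e∈p' , inj₁ (refl , refl) = disjoint (lose (p⊆w xy∈p) (p'⊆w' e∈p'))
    ... | _ , e∈p' , inj₂ (refl , refl) = asym (∈steps⇒R w (p⊆w xy∈p)) (∈steps⇒R w' (p'⊆w' e∈p'))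

  PairwiseArcDisjoint : ∀ {n k} {R : BoolRel n} {s t} → (Fin k → Walk R s t) → Set
  PairwiseArcDisjoint W = ∀ i j → i ≢ j → ¬ ShareArc (W i) (W j)

  ShareArc-mapWalk⁻ : ∀ {n} {R S : BoolRel n} (R⊆S : R ⊆ʳ S) {u v u' v'} (p : Walk R u v) (q : Walk R u' v') →
    ShareArc (mapWalk R⊆S p) (mapWalk R⊆S q) → ShareArc p q
  ShareArc-mapWalk⁻ R⊆S p q =
    subst₂ (λ es es' → Any (_∈ es') es) (steps-mapWalk R⊆S p) (steps-mapWalk R⊆S q)

  avoiding⇒arcDisjoint : ∀ {n} {R S : BoolRel n} (S⊆R : S ⊆ʳ R) {u v u' v'} (p : Walk R u v) (q : Walk S u' v') →
    (∀ {a b} → (a , b) ∈ steps p → S a b ≡ false) → ¬ ShareArc p (mapWalk S⊆R q)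
  avoiding⇒arcDisjoint S⊆R p q avoids shared with find shared
  ... | _ , e∈p , e∈q with () ← trans (sym (avoids e∈p)) (∈steps⇒R q (subst (_ ∈_) (steps-mapWalk S⊆R q) e∈q))

module Flows where

  open Sums
  open Walks
  open import Data.Bool using (true)
  open import Data.Fin using (Fin; zero; suc; _≟_)
  open import Data.List using (List; []; _∷_)
  open import Data.List.Relation.Unary.All.Properties using (All¬⇒¬Any)
  open import Data.List.Relation.Unary.AllPairs using (_∷_)
  open import Data.List.Relation.Unary.Unique.Propositional using (Unique)
  open import Data.List.Relation.Unary.Any using (here; there)
  open import Data.List.Membership.Propositional using (_∈_; _∉_; lose)
  open import Data.Nat using (ℕ; zero; suc; _+_; _*_; _≤_; _<_; z≤n)
  open import Data.Nat.Properties hiding (_≟_)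
  open import Algebra.Properties.CommutativeSemigroup +-commutativeSemigroup
    using (interchange; x∙yz≈y∙xz; x∙yz≈yx∙z; xy∙z≈xz∙y; xy∙z≈y∙xz; x∙yz≈xz∙y)
  open import Data.Product using (_×_; _,_; proj₁; proj₂)
  open import Function using (_∘_)
  open import Relation.Nullary using (yes; no; contradiction)
  open import Relation.Binary.PropositionalEquality

  Weight : ℕ → Set
  Weight n = Fin n → Fin n → ℕ

  _⊕_ : ∀ {n} → Weight n → Weight n → Weight n
  (m ⊕ m') x y = m x y + m' x y

  module _ {n : ℕ} where

    outdeg indeg : Weight n → Fin n → ℕ
    outdeg m z = sumFin n (m z)
    indeg m z = sumFin n (λ y → m y z)

    -- The net outflow at z is supply z − demand z, written without truncated subtraction.
    Balanced : Weight n → (demand supply : Fin n → ℕ) → Set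
    Balanced m demand supply = ∀ z → outdeg m z + demand z ≡ indeg m z + supply z

    IsFlow : Weight n → (s t : Fin n) → ℕ → Set
    IsFlow m s t k = Balanced m (λ z → k * δ t z) (λ z → k * δ s z)

    Balanced-cong : ∀ {m m' d d' s s'} → (∀ x y → m x y ≡ m' x y) → (∀ z → d z ≡ d' z) →
      (∀ z → s z ≡ s' z) → Balanced m d s → Balanced m' d' s'
    Balanced-cong {m} {m'} {d} {d'} {s} {s'} m≗m' d≗d' s≗s' bal z = begin
      outdeg m' z + d' z  ≡⟨ cong₂ _+_ (sumFin-cong n (m≗m' z)) (d≗d' z) ⟨
      outdeg m z + d z    ≡⟨ bal z ⟩
      indeg m z + s z     ≡⟨ cong₂ _+_ (sumFin-cong n (λ y → m≗m' y z)) (s≗s' z) ⟩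
      indeg m' z + s' z   ∎
      where open ≡-Reasoning

    Balanced-zero : ∀ {d} → Balanced (λ _ _ → 0) d d
    Balanced-zero z = refl

    Balanced-+ : ∀ {m m' d d' s s'} → Balanced m d s → Balanced m' d' s' →
      Balanced (m ⊕ m') (λ z → d z + d' z) (λ z → s z + s' z)
    Balanced-+ {m} {m'} {d} {d'} {s} {s'} bal bal' z = begin
      outdeg (m ⊕ m') z + (d z + d' z)            ≡⟨ cong (_+ _) (sumFin-distrib-+ n (m z) (m' z)) ⟩
      (outdeg m z + outdeg m' z) + (d z + d' z)   ≡⟨ interchange (outdeg m z) (outdeg m' z) (d z) (d' z) ⟩
      (outdeg m z + d z) + (outdeg m' z + d' z)   ≡⟨ cong₂ _+_ (bal z) (bal' z) ⟩
      (indeg m z + s z) + (indeg m' z + s' z)     ≡⟨ interchange (indeg m z) (s z) (indeg m' z) (s' z) ⟩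
      (indeg m z + indeg m' z) + (s z + s' z)     ≡⟨ cong (_+ _) (sumFin-distrib-+ n _ _) ⟨
      indeg (m ⊕ m') z + (s z + s' z)             ∎
      where open ≡-Reasoning

    Balanced-sum : ∀ k {m : Fin k → Weight n} {d s : Fin k → Fin n → ℕ} →
      (∀ i → Balanced (m i) (d i) (s i)) →
      Balanced (λ x y → sumFin k (λ i → m i x y)) (λ z → sumFin k (λ i → d i z)) (λ z → sumFin k (λ i → s i z))
    Balanced-sum zero bal = Balanced-zero
    Balanced-sum (suc k) bal = Balanced-+ (bal zero) (Balanced-sum k (bal ∘ suc))

    Balanced-transpose : ∀ {m d s} → Balanced m d s → Balanced (λ x y → m y x) s d
    Balanced-transpose bal z = sym (bal z)

    Balanced-cancel : ∀ {m d s} (e : Fin n → ℕ) → Balanced m (λ z → e z + d z) (λ z → e z + s z) → Balanced m d s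
    Balanced-cancel {m} {d} {s} e bal z = +-cancelˡ-≡ (e z) _ _ (begin
      e z + (outdeg m z + d z)   ≡⟨ x∙yz≈y∙xz (e z) (outdeg m z) (d z) ⟩
      outdeg m z + (e z + d z)   ≡⟨ bal z ⟩
      indeg m z + (e z + s z)    ≡⟨ x∙yz≈y∙xz (indeg m z) (e z) (s z) ⟩
      e z + (indeg m z + s z)    ∎)
      where open ≡-Reasoning

    -- Only the antisymmetric part m x y − m y x of a weight enters its balance.
    Balanced-antisymmetric : ∀ {m m' d s} → (∀ x y → m x y + m' y x ≡ m' x y + m y x) →
      Balanced m d s → Balanced m' d s
    Balanced-antisymmetric {m} {m'} {d} {s} same bal z = +-cancelʳ-≡ (indeg m z) _ _ (begin
      (outdeg m' z + d z) + indeg m z    ≡⟨ xy∙z≈xz∙y (outdeg m' z) (d z) (indeg m z) ⟩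
      (outdeg m' z + indeg m z) + d z    ≡⟨ cong (_+ d z) degrees ⟨
      (outdeg m z + indeg m' z) + d z    ≡⟨ xy∙z≈y∙xz (outdeg m z) (indeg m' z) (d z) ⟩
      indeg m' z + (outdeg m z + d z)    ≡⟨ cong (indeg m' z +_) (bal z) ⟩
      indeg m' z + (indeg m z + s z)     ≡⟨ x∙yz≈xz∙y (indeg m' z) (indeg m z) (s z) ⟩
      (indeg m' z + s z) + indeg m z     ∎)
      where
      open ≡-Reasoning
      degrees : outdeg m z + indeg m' z ≡ outdeg m' z + indeg m z
      degrees = begin
        outdeg m z + indeg m' z               ≡⟨ sumFin-distrib-+ n _ _ ⟨
        sumFin n (λ y → m z y + m' y z)       ≡⟨ sumFin-cong n (same z) ⟩
        sumFin n (λ y → m' z y + m y z)       ≡⟨ sumFin-distrib-+ n _ _ ⟩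
        outdeg m' z + indeg m z               ∎

    unitArc : Fin n → Fin n → Weight n
    unitArc a b x y = δ a x * δ b y

    outdeg-unitArc : ∀ a b z → outdeg (unitArc a b) z ≡ δ a z
    outdeg-unitArc a b z = begin
      sumFin n (λ y → δ a z * δ b y)  ≡⟨ sumFin-distribˡ-* n (δ a z) (δ b) ⟩
      δ a z * sumFin n (δ b)          ≡⟨ cong (δ a z *_) (sumFin-δ b) ⟩
      δ a z * 1                       ≡⟨ *-identityʳ (δ a z) ⟩
      δ a z                           ∎
      where open ≡-Reasoning

    indeg-unitArc : ∀ a b z → indeg (unitArc a b) z ≡ δ b z
    indeg-unitArc a b z = begin
      sumFin n (λ x → δ a x * δ b z)  ≡⟨ sumFin-distribʳ-* n (δ b z) (δ a) ⟩
      sumFin n (δ a) * δ b z          ≡⟨ cong (_* δ b z) (sumFin-δ a) ⟩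
      1 * δ b z                       ≡⟨ *-identityˡ (δ b z) ⟩
      δ b z                           ∎
      where open ≡-Reasoning

    unitArc-balanced : ∀ a b → Balanced (unitArc a b) (δ b) (δ a)
    unitArc-balanced a b z = begin
      outdeg (unitArc a b) z + δ b z  ≡⟨ cong₂ _+_ (outdeg-unitArc a b z) (sym (indeg-unitArc a b z)) ⟩
      δ a z + indeg (unitArc a b) z   ≡⟨ +-comm (δ a z) _ ⟩
      indeg (unitArc a b) z + δ a z   ∎
      where open ≡-Reasoning

    Balanced-unitArc⁻ : ∀ {a b m d s} → Balanced (unitArc a b ⊕ m) d s →
      Balanced m (λ z → δ a z + d z) (λ z → δ b z + s z)
    Balanced-unitArc⁻ {a} {b} {m} {d} {s} bal z = begin
      outdeg m z + (δ a z + d z)                   ≡⟨ x∙yz≈yx∙z (outdeg m z) (δ a z) (d z) ⟩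
      (δ a z + outdeg m z) + d z                   ≡⟨ cong (λ k → (k + outdeg m z) + d z) (outdeg-unitArc a b z) ⟨
      (outdeg (unitArc a b) z + outdeg m z) + d z  ≡⟨ cong (_+ d z) (sumFin-distrib-+ n _ _) ⟨
      outdeg (unitArc a b ⊕ m) z + d z             ≡⟨ bal z ⟩
      indeg (unitArc a b ⊕ m) z + s z              ≡⟨ cong (_+ s z) (sumFin-distrib-+ n _ _) ⟩
      (indeg (unitArc a b) z + indeg m z) + s z    ≡⟨ cong (λ k → (k + indeg m z) + s z) (indeg-unitArc a b z) ⟩
      (δ b z + indeg m z) + s z                    ≡⟨ xy∙z≈y∙xz (δ b z) (indeg m z) (s z) ⟩
      indeg m z + (δ b z + s z)                    ∎
      where open ≡-Reasoning

    arcCount : List (Fin n × Fin n) → Weight n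
    arcCount [] x y = 0
    arcCount ((a , b) ∷ es) x y = unitArc a b x y + arcCount es x y

    walk-balanced : ∀ {R : BoolRel n} {s t} (p : Walk R s t) → Balanced (arcCount (steps p)) (δ t) (δ s)
    walk-balanced stop = Balanced-zero
    walk-balanced (step {u = u} {w = w} _ p) =
      Balanced-cancel (δ w) (Balanced-cong (λ _ _ → refl) (λ _ → refl) (λ z → +-comm (δ u z) (δ w z))
        (Balanced-+ (unitArc-balanced u w) (walk-balanced p)))

    arcCount-positive⇒∈ : ∀ es {x y} → 0 < arcCount es x y → (x , y) ∈ es
    arcCount-positive⇒∈ ((a , b) ∷ es) {x} {y} positive with a ≟ x | b ≟ y
    ... | yes refl | yes refl = here refl
    ... | yes refl | no _ = there (arcCount-positive⇒∈ es positive)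
    ... | no _ | _ = there (arcCount-positive⇒∈ es positive)

    arcCount-∉ : ∀ {R : BoolRel n} {s t} (p : Walk R s t) {x} y → x ∉ verts p → arcCount (steps p) x y ≡ 0
    arcCount-∉ p y x∉p = n≤0⇒n≡0 (≮⇒≥ (x∉p ∘ ∈steps⇒∈verts p ∘ arcCount-positive⇒∈ (steps p)))

    path-arcCount≤1 : ∀ {R : BoolRel n} {s t} (p : Walk R s t) → Unique (verts p) →
      ∀ x y → arcCount (steps p) x y ≤ 1
    path-arcCount≤1 stop _ x y = z≤n
    path-arcCount≤1 (step {u = u} {w = w} _ p) (u∉p ∷ p!) x y with u ≟ x
    ... | no _ = path-arcCount≤1 p p! x y
    ... | yes refl = begin
      1 * δ w y + arcCount (steps p) u y  ≡⟨ cong₂ _+_ (*-identityˡ (δ w y)) (arcCount-∉ p y (All¬⇒¬Any u∉p)) ⟩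
      δ w y + 0                           ≡⟨ +-identityʳ (δ w y) ⟩
      δ w y                               ≤⟨ δ≤1 w y ⟩
      1                                   ∎
      where open ≤-Reasoning

    familyWeight : ∀ {k} {R : BoolRel n} {s t} → (Fin k → Path R s t) → Weight n
    familyWeight {k} P x y = sumFin k (λ i → arcCount (steps (proj₁ (P i))) x y)

    module _ {k} {R : BoolRel n} {s t} (P : Fin k → Path R s t) where

      familyWeight-isFlow : IsFlow (familyWeight P) s t k
      familyWeight-isFlow =
        Balanced-cong (λ _ _ → refl) (λ z → sumFin-const k (δ t z)) (λ z → sumFin-const k (δ s z))
          (Balanced-sum k (λ i → walk-balanced (proj₁ (P i))))

      familyWeight-positive⇒R : ∀ {x y} → 0 < familyWeight P x y → R x y ≡ true
      familyWeight-positive⇒R positive with sumFin-positive k _ positive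
      ... | i , used = ∈steps⇒R (proj₁ (P i)) (arcCount-positive⇒∈ _ used)

      familyWeight≤1 : PairwiseArcDisjoint (proj₁ ∘ P) → ∀ x y → familyWeight P x y ≤ 1
      familyWeight≤1 disjoint x y =
        sumFin-≤1 k _ (λ i → path-arcCount≤1 (proj₁ (P i)) (proj₂ (P i)) x y) same-path
        where
        same-path : ∀ i j → 0 < arcCount (steps (proj₁ (P i))) x y →
          0 < arcCount (steps (proj₁ (P j))) x y → i ≡ j
        same-path i j i-uses j-uses with i ≟ j
        ... | yes i≡j = i≡j
        ... | no i≢j = contradiction (lose (arcCount-positive⇒∈ _ i-uses) (arcCount-positive⇒∈ _ j-uses))
                                     (disjoint i j i≢j)

module FlowDecomposition where

  open Sums
  open Walks
  open Flows
  open import Data.Bool using (true; false; _∧_; not)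
  open import Data.Bool.Properties using (∧-conicalˡ; ∧-identityʳ; ∧-zeroʳ; ¬-not; not-¬)
  open import Data.Fin using (Fin; zero; suc; _≟_)
  open import Data.List.Relation.Unary.Any using (here; there)
  open import Data.List.Membership.Propositional using (_∈_)
  open import Data.Nat using (ℕ; zero; suc; _+_; _*_; _<_; z<s)
  open import Data.Nat.Properties hiding (_≟_)
  open import Algebra.Properties.CommutativeSemigroup +-commutativeSemigroup using (x∙yz≈y∙xz)
  open import Data.Product using (Σ; ∃; _,_; proj₁; proj₂)
  open import Function using (_∘_)
  open import Relation.Nullary using (does; yes; no; contradiction)
  open import Relation.Nullary.Decidable using (dec-true)
  open import Relation.Binary.PropositionalEquality

  module _ {n : ℕ} where

    𝟙ʳ : BoolRel n → Weight n
    𝟙ʳ H x y = 𝟙 (H x y)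

    arcTotal : BoolRel n → ℕ
    arcTotal H = sumFin n (outdeg (𝟙ʳ H))

    removeArc : BoolRel n → Fin n → Fin n → BoolRel n
    removeArc H x y a b = H a b ∧ not (does (x ≟ a) ∧ does (y ≟ b))

    removeArc⊆ : ∀ H x y → removeArc H x y ⊆ʳ H
    removeArc⊆ H x y {a} {b} = ∧-conicalˡ (H a b) _

    removeArc-removes : ∀ H x y → removeArc H x y x y ≡ false
    removeArc-removes H x y rewrite dec-true (x ≟ x) refl | dec-true (y ≟ y) refl = ∧-zeroʳ (H x y)

    module _ {H : BoolRel n} {x y : Fin n} (Hxy : H x y ≡ true) where

      𝟙ʳ-removeArc : ∀ a b → 𝟙ʳ H a b ≡ (unitArc x y ⊕ 𝟙ʳ (removeArc H x y)) a b
      𝟙ʳ-removeArc a b with x ≟ a | y ≟ b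
      ... | yes refl | yes refl rewrite Hxy = refl
      ... | yes refl | no _ = cong 𝟙 (sym (∧-identityʳ (H a b)))
      ... | no _ | _ = cong 𝟙 (sym (∧-identityʳ (H a b)))

      arcTotal-removeArc : arcTotal H ≡ suc (arcTotal (removeArc H x y))
      arcTotal-removeArc = begin
        sumFin n (outdeg (𝟙ʳ H))                     ≡⟨ sumFin-cong n (λ z → sumFin-cong n (𝟙ʳ-removeArc z)) ⟩
        sumFin n (outdeg (unitArc x y ⊕ 𝟙ʳ H'))      ≡⟨ sumFin-cong n (λ z → sumFin-distrib-+ n _ _) ⟩
        sumFin n (λ z → outdeg (unitArc x y) z + outdeg (𝟙ʳ H') z)
                                                     ≡⟨ sumFin-distrib-+ n _ _ ⟩
        sumFin n (outdeg (unitArc x y)) + arcTotal H' ≡⟨ cong (_+ arcTotal H') (sumFin-cong n (outdeg-unitArc x y)) ⟩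
        sumFin n (δ x) + arcTotal H'                 ≡⟨ cong (_+ arcTotal H') (sumFin-δ x) ⟩
        suc (arcTotal H')                            ∎
        where
        open ≡-Reasoning
        H' = removeArc H x y

      Balanced-removeArc : ∀ {d f : Fin n → ℕ} → Balanced (𝟙ʳ H) d (λ z → δ x z + f z) →
        Balanced (𝟙ʳ (removeArc H x y)) d (λ z → δ y z + f z)
      Balanced-removeArc {d} {f} bal =
        Balanced-cancel (δ x) (Balanced-cong (λ _ _ → refl) (λ _ → refl) (λ z → x∙yz≈y∙xz (δ y z) (δ x z) (f z))
          (Balanced-unitArc⁻ {a = x} {b = y} (Balanced-cong 𝟙ʳ-removeArc (λ _ → refl) (λ _ → refl) bal)))

    module _ {t : Fin n} where

      record WalkExtraction (H : BoolRel n) (x : Fin n) (c : ℕ) (f : Fin n → ℕ) : Set where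
        field
          residual : BoolRel n
          residual⊆H : residual ⊆ʳ H
          residual-balanced : Balanced (𝟙ʳ residual) (λ z → c * δ t z) f
          walk : Walk H x t
          walk-avoids-residual : ∀ {a b} → (a , b) ∈ steps walk → residual a b ≡ false

      out-arc-at-source : ∀ {H x c} {f : Fin n → ℕ} → x ≢ t →
        Balanced (𝟙ʳ H) (λ z → suc c * δ t z) (λ z → δ x z + f z) → ∃ λ y → H x y ≡ true
      out-arc-at-source {H} {x} {c} {f} x≢t bal with sumFin-positive n (𝟙ʳ H x) outdeg>0
        where
        open ≤-Reasoning
        outdeg>0 : 0 < outdeg (𝟙ʳ H) x
        outdeg>0 = begin-strict
          0                                   <⟨ z<s ⟩
          suc (f x)                           ≤⟨ m≤n+m (suc (f x)) _ ⟩
          indeg (𝟙ʳ H) x + suc (f x)          ≡⟨ cong (λ k → indeg (𝟙ʳ H) x + (k + f x)) (δ-refl x) ⟨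
          indeg (𝟙ʳ H) x + (δ x x + f x)      ≡⟨ bal x ⟨
          outdeg (𝟙ʳ H) x + suc c * δ t x     ≡⟨ cong (λ k → outdeg (𝟙ʳ H) x + suc c * k) (δ-≢ (x≢t ∘ sym)) ⟩
          outdeg (𝟙ʳ H) x + suc c * 0         ≡⟨ cong (outdeg (𝟙ʳ H) x +_) (*-zeroʳ (suc c)) ⟩
          outdeg (𝟙ʳ H) x + 0                 ≡⟨ +-identityʳ _ ⟩
          outdeg (𝟙ʳ H) x                     ∎
      ... | y , positive = y , 𝟙-positive positive

      prependArc : ∀ {H x y c} {f : Fin n → ℕ} (Hxy : H x y ≡ true) →
        WalkExtraction (removeArc H x y) y c f → WalkExtraction H x c f
      prependArc {H} {x} {y} Hxy E = record
        { residual = residual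
        ; residual⊆H = removeArc⊆ H x y ∘ residual⊆H
        ; residual-balanced = residual-balanced
        ; walk = step Hxy (mapWalk (removeArc⊆ H x y) walk)
        ; walk-avoids-residual = avoids
        }
        where
        open WalkExtraction E
        avoids : ∀ {a b} → (a , b) ∈ steps (step Hxy (mapWalk (removeArc⊆ H x y) walk)) → residual a b ≡ false
        avoids (here refl) = ¬-not (not-¬ (removeArc-removes H x y) ∘ residual⊆H)
        avoids (there e∈walk) =
          walk-avoids-residual (subst (_ ∈_) (steps-mapWalk (removeArc⊆ H x y) walk) e∈walk)

      -- Follow out-arcs from x, deleting each arc used; the balance forces the walk to end at t.
      extractWalk : ∀ N {H x c} {f : Fin n → ℕ} → arcTotal H ≡ N →
        Balanced (𝟙ʳ H) (λ z → suc c * δ t z) (λ z → δ x z + f z) → WalkExtraction H x c f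
      extractWalk N {H} {x} {c} total bal with x ≟ t
      ... | yes refl = record
        { residual = H
        ; residual⊆H = λ Hab → Hab
        ; residual-balanced = Balanced-cancel (δ x) bal
        ; walk = stop
        ; walk-avoids-residual = λ ()
        }
      ... | no x≢t with out-arc-at-source {c = c} x≢t bal
      ... | y , Hxy with N | arcTotal-removeArc {H} {x} {y} Hxy
      ... | zero | total′ = contradiction (trans (sym total) total′) 0≢1+n
      ... | suc N | total′ =
        prependArc Hxy (extractWalk N (suc-injective (trans (sym total′) total)) (Balanced-removeArc Hxy bal))

    flowDecomposition : ∀ k {H : BoolRel n} {s t} → IsFlow (𝟙ʳ H) s t k →
      Σ (Fin k → Walk H s t) PairwiseArcDisjoint
    flowDecomposition zero _ = (λ ()) , λ ()
    flowDecomposition (suc k) {H} {s} {t} flow = W , W-disjoint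
      where
      open WalkExtraction (extractWalk {t} (arcTotal H) {H} {s} {k} refl flow)
      rest = flowDecomposition k residual-balanced
      W : Fin (suc k) → Walk H s t
      W zero = walk
      W (suc i) = mapWalk residual⊆H (proj₁ rest i)
      W-disjoint : PairwiseArcDisjoint W
      W-disjoint zero zero 0≢0 = contradiction refl 0≢0
      W-disjoint zero (suc j) _ = avoiding⇒arcDisjoint residual⊆H walk (proj₁ rest j) walk-avoids-residual
      W-disjoint (suc i) zero _ =
        avoiding⇒arcDisjoint residual⊆H walk (proj₁ rest i) walk-avoids-residual ∘ ShareArc-sym (W (suc i)) walk
      W-disjoint (suc i) (suc j) i≢j =
        proj₂ rest i j (i≢j ∘ cong suc) ∘ ShareArc-mapWalk⁻ residual⊆H (proj₁ rest i) (proj₁ rest j)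

module PairBound where

  open Sums
  open Walks
  open Flows
  open FlowDecomposition using (𝟙ʳ; flowDecomposition)
  open import Data.Bool using (true)
  open import Data.Bool.Properties using (not-¬)
  open import Data.Empty using (⊥)
  open import Data.Fin using (Fin)
  open import Data.List.Membership.Propositional using (_∈_)
  open import Data.Nat using (ℕ; zero; suc; _+_; _≤_; _<_; _<?_; z≤n; s≤s; z<s)
  open import Data.Nat.Properties using (*-distribʳ-+; +-identityʳ; <-asym; ≤-<-trans; ≤-trans; ≤-reflexive)
  open import Data.Product using (_,_; proj₁; proj₂)
  open import Data.Sum using (_⊎_; inj₁; inj₂)
  open import Function using (_∘_)
  open import Relation.Nullary using (Dec; yes; no; does; contradiction)
  open import Relation.Binary.PropositionalEquality

  exclusive-+≤1 : ∀ {a b} → a ≤ 1 → b ≤ 1 → (0 < a → 0 < b → ⊥) → a + b ≤ 1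
  exclusive-+≤1 z≤n b≤1 _ = b≤1
  exclusive-+≤1 {b = zero} a≤1 _ _ = ≤-trans (≤-reflexive (+-identityʳ _)) a≤1
  exclusive-+≤1 {suc _} {suc _} _ _ exclusive = contradiction z<s (exclusive z<s)

  +-positive : ∀ a {b} → 0 < a + b → 0 < a ⊎ 0 < b
  +-positive zero positive = inj₂ positive
  +-positive (suc a) _ = inj₁ z<s

  -- For 0/1 values, 𝟙 (s' < s) = s ∸ s'.
  bits-net : ∀ {s s'} → s ≤ 1 → s' ≤ 1 → s + 𝟙 (does (s <? s')) ≡ 𝟙 (does (s' <? s)) + s'
  bits-net z≤n z≤n = refl
  bits-net z≤n (s≤s z≤n) = refl
  bits-net (s≤s z≤n) z≤n = refl
  bits-net (s≤s z≤n) (s≤s z≤n) = refl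

  does⇒witness : ∀ {A : Set} (a? : Dec A) → does a? ≡ true → A
  does⇒witness (yes a) _ = a
  does⇒witness (no _) ()

  module _ {n} (G : Graph n) (D : Orientation G) {u v : Fin n} {a b : ℕ}
    (forward : HasArcDisjoint D u v a) (backward : HasArcDisjoint D v u b) where

    -- The backward paths are traversed in reverse, so that both families flow from u to v.
    combined : Weight n
    combined x y = familyWeight (proj₁ forward) x y + familyWeight (proj₁ backward) y x

    combined-isFlow : IsFlow combined u v (a + b)
    combined-isFlow =
      Balanced-cong (λ _ _ → refl) (λ z → sym (*-distribʳ-+ (δ v z) a b)) (λ z → sym (*-distribʳ-+ (δ u z) a b))
        (Balanced-+ (familyWeight-isFlow (proj₁ forward)) (Balanced-transpose (familyWeight-isFlow (proj₁ backward))))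

    combined≤1 : ∀ x y → combined x y ≤ 1
    combined≤1 x y =
      exclusive-+≤1 (familyWeight≤1 (proj₁ forward) (proj₂ forward) x y) (familyWeight≤1 (proj₁ backward) (proj₂ backward) y x)
        λ forward-uses backward-uses →
          not-¬ (antisym D x y (familyWeight-positive⇒R (proj₁ forward) forward-uses))
                (familyWeight-positive⇒R (proj₁ backward) backward-uses)

    net : BoolRel n
    net x y = does (combined y x <? combined x y)

    net-isFlow : IsFlow (𝟙ʳ net) u v (a + b)
    net-isFlow = Balanced-antisymmetric (λ x y → bits-net (combined≤1 x y) (combined≤1 y x)) combined-isFlow

    net⇒< : ∀ {x y} → net x y ≡ true → combined y x < combined x y
    net⇒< {x} {y} = does⇒witness (combined y x <? combined x y)

    net-asym : ∀ {x y} → net x y ≡ true → net y x ≡ true → ⊥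
    net-asym net-xy net-yx = <-asym (net⇒< net-xy) (net⇒< net-yx)

    net⊆adj : net ⊆ʳ adj G
    net⊆adj {x} {y} net-xy with +-positive _ (≤-<-trans z≤n (net⇒< net-xy))
    ... | inj₁ forward-uses = arc⊆adj D x y (familyWeight-positive⇒R (proj₁ forward) forward-uses)
    ... | inj₂ backward-uses =
      trans (Graph.sym G x y) (arc⊆adj D y x (familyWeight-positive⇒R (proj₁ backward) backward-uses))

    edgeDisjoint : HasEdgeDisjoint G u v (a + b)
    edgeDisjoint = proj₁ ∘ path , λ i j i≢j →
      arcDisjoint⇒edgeDisjoint net-asym (W i) (W j) _ _ (path⊆W i) (path⊆W j) (proj₂ decomposition i j i≢j)
      where
      decomposition = flowDecomposition (a + b) net-isFlow
      W = proj₁ decomposition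
      path = λ i → walk⇒path (mapWalk net⊆adj (W i))
      path⊆W : ∀ i {e} → e ∈ steps (proj₁ (proj₁ (path i))) → e ∈ steps (W i)
      path⊆W i = subst (_ ∈_) (steps-mapWalk net⊆adj (W i)) ∘ proj₂ (path i)

  lambdaD+lambdaD≤lambdaG : ∀ {n} (G : Graph n) (D : Orientation G) {u v g d d'} →
    IsLambdaG G u v g → IsLambdaD D u v d → IsLambdaD D v u d' → d + d' ≤ g
  lambdaD+lambdaD≤lambdaG G D (_ , maximal) (forward , _) (backward , _) =
    maximal _ (edgeDisjoint G D forward backward)

module PairSums where

  open Sums
  open PairBound using (lambdaD+lambdaD≤lambdaG)
  open import Data.Bool using (Bool; true; false; if_then_else_)
  open import Data.Fin using (Fin; _≟_; _<?_; _<_)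
  open import Data.Fin.Properties using (<-cmp; <-asym; <-irrefl)
  open import Data.Nat using (ℕ; _+_; _≤_; z≤n)
  open import Data.Nat.Properties using (+-identityʳ; module ≤-Reasoning)
  open import Function using (_∘_)
  open import Relation.Binary.Definitions using (tri<; tri≈; tri>)
  open import Relation.Nullary using (does; yes; no)
  open import Relation.Nullary.Decidable using (dec-true; dec-false)
  open import Relation.Binary.PropositionalEquality

  if-+ : ∀ (c : Bool) x y → (if c then x + y else 0) ≡ (if c then x else 0) + (if c then y else 0)
  if-+ true x y = refl
  if-+ false x y = refl

  ordered-split : ∀ {n} (u v : Fin n) x →
    (if does (u ≟ v) then 0 else x) ≡ (if does (u <? v) then x else 0) + (if does (v <? u) then x else 0)
  ordered-split u v x with <-cmp u v
  ... | tri< u<v u≢v _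
    rewrite dec-false (u ≟ v) u≢v | dec-true (u <? v) u<v | dec-false (v <? u) (<-asym u<v) = sym (+-identityʳ x)
  ... | tri≈ _ refl _ rewrite dec-true (u ≟ u) refl | dec-false (u <? u) (<-irrefl refl) = refl
  ... | tri> _ u≢v v<u
    rewrite dec-false (u ≟ v) u≢v | dec-false (u <? v) (<-asym v<u) | dec-true (v <? u) v<u = refl

  sumFin²-distrib-+ : ∀ n (f g : Fin n → Fin n → ℕ) →
    sumFin n (λ u → sumFin n (λ v → f u v + g u v)) ≡ sumFin n (λ u → sumFin n (f u)) + sumFin n (λ u → sumFin n (g u))
  sumFin²-distrib-+ n f g = trans (sumFin-cong n (λ u → sumFin-distrib-+ n (f u) (g u))) (sumFin-distrib-+ n _ _)

  sumUnordered-distrib-+ : ∀ n (f g : Fin n → Fin n → ℕ) →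
    sumUnordered n (λ u v → f u v + g u v) ≡ sumUnordered n f + sumUnordered n g
  sumUnordered-distrib-+ n f g =
    trans (sumFin-cong n (λ u → sumFin-cong n (λ v → if-+ (does (u <? v)) (f u v) (g u v)))) (sumFin²-distrib-+ n _ _)

  sumOrdered≡sumUnordered : ∀ n (f : Fin n → Fin n → ℕ) →
    sumOrdered n f ≡ sumUnordered n (λ u v → f u v + f v u)
  sumOrdered≡sumUnordered n f = begin
    sumOrdered n f
      ≡⟨ sumFin-cong n (λ u → sumFin-cong n (λ v → ordered-split u v (f u v))) ⟩
    sumFin n (λ u → sumFin n (λ v → (if does (u <? v) then f u v else 0) + (if does (v <? u) then f u v else 0)))
      ≡⟨ sumFin²-distrib-+ n _ _ ⟩
    sumUnordered n f + sumFin n (λ u → sumFin n (λ v → if does (v <? u) then f u v else 0))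
      ≡⟨ cong (sumUnordered n f +_) (sumFin-comm n n _) ⟩
    sumUnordered n f + sumUnordered n (λ u v → f v u)
      ≡⟨ sumUnordered-distrib-+ n _ _ ⟨
    sumUnordered n (λ u v → f u v + f v u) ∎
    where open ≡-Reasoning

  sumUnordered-mono-≤ : ∀ n {f g : Fin n → Fin n → ℕ} → (∀ u v → u < v → f u v ≤ g u v) →
    sumUnordered n f ≤ sumUnordered n g
  sumUnordered-mono-≤ n {f} {g} f≤g = sumFin-mono-≤ n (λ u → sumFin-mono-≤ n (λ v → pointwise u v))
    where
    pointwise : ∀ u v → (if does (u <? v) then f u v else 0) ≤ (if does (u <? v) then g u v else 0)
    pointwise u v with u <? v
    ... | yes u<v rewrite dec-true (u <? v) u<v = f≤g u v u<v
    ... | no u≮v rewrite dec-false (u <? v) u≮v = z≤n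

  sumOrdered-lambdaD≤sumUnordered-lambdaG : ∀ {n} (G : Graph n) (D : Orientation G) (g d : Fin n → Fin n → ℕ) →
    (∀ u v → u ≢ v → IsLambdaG G u v (g u v)) → (∀ u v → u ≢ v → IsLambdaD D u v (d u v)) →
    sumOrdered n d ≤ sumUnordered n g
  sumOrdered-lambdaD≤sumUnordered-lambdaG {n} G D g d isG isD = begin
    sumOrdered n d                          ≡⟨ sumOrdered≡sumUnordered n d ⟩
    sumUnordered n (λ u v → d u v + d v u)  ≤⟨ sumUnordered-mono-≤ n pair-bound ⟩
    sumUnordered n g                        ∎
    where
    open ≤-Reasoning
    pair-bound : ∀ u v → u < v → d u v + d v u ≤ g u v
    pair-bound u v u<v = lambdaD+lambdaD≤lambdaG G D (isG u v u≢v) (isD u v u≢v) (isD v u (u≢v ∘ sym))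
      where
      u≢v : u ≢ v
      u≢v u≡v = <-irrefl u≡v u<v

open import Data.Nat using (ℕ; suc)
open import Data.Fin using (Fin)
open import Relation.Binary.PropositionalEquality using (_≢_)
open import Data.Rational using (0ℚ; ½; _*_; _<_; _≤_)

import Data.Nat as ℕ
import Data.Nat.Properties as ℕ
import Data.Integer as ℤ
import Data.Integer.Properties as ℤ
open import Data.Integer using (+_)
open import Data.Rational using (_/_; toℚᵘ)
open import Data.Rational.Properties using (toℚᵘ-cancel-≤; toℚᵘ-fromℚᵘ; toℚᵘ-homo-*)
open import Data.Rational.Unnormalised as ℚᵘ using (mkℚᵘ; *≤*)
import Data.Rational.Unnormalised.Properties as ℚᵘ
open import Data.Nat.Tactic.RingSolver using (solve-∀)
open import Relation.Binary.PropositionalEquality using (_≡_; trans; sym; cong; subst₂)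

ratio≤half-ratio : ∀ S T k → S ℕ.≤ T → (+ S) / suc k ≤ ½ * ((+ (2 ℕ.* T)) / suc k)
-- (+ i) / suc k unfolds to fromℚᵘ (mkℚᵘ (+ i) k), so both sides can be compared in ℚᵘ.
ratio≤half-ratio S T k S≤T = toℚᵘ-cancel-≤ (begin
  toℚᵘ ((+ S) / suc k)                         ≃⟨ toℚᵘ-fromℚᵘ (mkℚᵘ (+ S) k) ⟩
  mkℚᵘ (+ S) k                                 ≤⟨ *≤* cross-multiplied ⟩
  toℚᵘ ½ ℚᵘ.* mkℚᵘ (+ (2 ℕ.* T)) k              ≃⟨ ℚᵘ.*-congˡ {toℚᵘ ½} (toℚᵘ-fromℚᵘ (mkℚᵘ (+ (2 ℕ.* T)) k)) ⟨
  toℚᵘ ½ ℚᵘ.* toℚᵘ ((+ (2 ℕ.* T)) / suc k)      ≃⟨ toℚᵘ-homo-* ½ ((+ (2 ℕ.* T)) / suc k) ⟨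
  toℚᵘ (½ * ((+ (2 ℕ.* T)) / suc k))           ∎)
  where
  open ℚᵘ.≤-Reasoning
  rearrange : ∀ T K → T ℕ.* (2 ℕ.* K) ≡ (2 ℕ.* T) ℕ.* K
  rearrange = solve-∀
  cross-multiplied : + S ℤ.* + (2 ℕ.* suc k) ℤ.≤ (+ 1 ℤ.* + (2 ℕ.* T)) ℤ.* + suc k
  cross-multiplied = subst₂ ℤ._≤_ (ℤ.pos-* S (2 ℕ.* suc k))
    (trans (ℤ.pos-* (2 ℕ.* T) (suc k)) (cong (ℤ._* + suc k) (sym (ℤ.*-identityˡ (+ (2 ℕ.* T))))))
    (ℤ.+≤+ (ℕ.≤-trans (ℕ.*-monoˡ-≤ (2 ℕ.* suc k) S≤T) (ℕ.≤-reflexive (rearrange T (suc k)))))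

theorem2p5 : (m : ℕ) (G : Graph (suc (suc m)))
    (lamG : Fin (suc (suc m)) → Fin (suc (suc m)) → ℕ) →
    (∀ u v → u ≢ v → IsLambdaG G u v (lamG u v)) →
    0ℚ < avgUnordered m lamG →
    (D : Orientation G) (lamD : Fin (suc (suc m)) → Fin (suc (suc m)) → ℕ) →
    (∀ u v → u ≢ v → IsLambdaD D u v (lamD u v)) →
    avgOrdered m lamD ≤ ½ * avgUnordered m lamG
-- λ̄(G) > 0 only makes the ratio of the paper defined; the product form holds without it.
theorem2p5 m G lamG isLambdaG _ D lamD isLambdaD =
  ratio≤half-ratio _ _ _ (PairSums.sumOrdered-lambdaD≤sumUnordered-lambdaG G D lamG lamD isLambdaG isLambdaD)
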